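{- Let $\Psi$ be a context of parameters with positive types and $M$ a simple linear pattern with $\Psi\vdash M\Uparrow A$. If $\Psi\vdash\mathrm{Not}(M)\Rightarrow N:A$, then $N$ is a simple linear pattern and $\Psi\vdash N\Uparrow A$.
   Context: Strict $\lambda$-calculus: labels $k\in\{1,0,u\}$; types $A::=a\mid A_1\to^kA_2$; terms $c\mid x\mid\lambda x^k{:}A.M\mid M_1M_2^k$, over a signature $\Sigma$. Positive types $P::=a\mid N\to^1P$, negative types $N::=a\mid P\to^uN$; constants of $\Sigma$ and parameters in $\Psi$ have positive types. Existential variables are a separate syntactic class. For $\Psi=x_1{:}A_1,\dots,x_n{:}A_n$ (fixed standard order) a label sequence is $\Phi=x_1^{k_1}\dots x_n^{k_n}$, $\Phi(x_i)=k_i$; $\Psi^u$ has all labels $u$. A generalized variable over $\Psi$ at atomic type $a$ is $E\,\Phi$ with $E$ of type $A_1\to^{k_1}\cdots A_n\to^{k_n}a$. Simple patterns $\Psi\vdash M\Uparrow A$: if $(\Psi,x{:}P)\vdash M\Uparrow B$ then $\Psi\vdash\lambda x^u{:}P.M\Uparrow P\to^uB$; if $h$ is a constant of $\Sigma$ or a variable of $\Psi$ of type $A_1\to^1\cdots\to^1A_n\to^1a$ and $\Psi\vdash M_i\Uparrow A_i$ for all $i$ then $\Psi\vdash h\,M_1^1\dots M_n^1\Uparrow a$; $\Psi\vdash E\,\Phi\Uparrow a$ for a generalized variable over $\Psi$. Linear: no existential variable occurs twice. Convention: for fresh $Z$, $Z\,\Phi$ at non-atomic type $B_1\to^u\cdots\to^uB_m\to^ua$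 stands for $\lambda y_1^u{:}B_1\dots\lambda y_m^u{:}B_m.Z\,\Phi\,y_1^u\dots y_m^u$. Complement: $\mathrm{Not}(1)=0$, $\mathrm{Not}(0)=1$, $\mathrm{Not}(u)=u$; if $\Phi(x_i)\in\{0,1\}$, $\mathrm{Not}_i(\Phi)$ gives $x_i$ label $\mathrm{Not}(\Phi(x_i))$ and all others label $u$ (undefined if $\Phi(x_i)=u$). $\Psi\vdash\mathrm{Not}(M)\Rightarrow N:A$ is defined by ($Z$'s fresh): if $\mathrm{Not}_i(\Phi)$ defined then $\Psi\vdash\mathrm{Not}(E\,\Phi)\Rightarrow Z\,\mathrm{Not}_i(\Phi):a$; if $(\Psi,x{:}A)\vdash\mathrm{Not}(M)\Rightarrow N:B$ then $\Psi\vdash\mathrm{Not}(\lambda x^u{:}A.M)\Rightarrow\lambda x^u{:}A.N:A\to^uB$; for $h\in\mathrm{dom}(\Sigma\cup\Psi)$ of type $A_1\to^1\cdots\to^1A_n\to^1a$: if $g\in\mathrm{dom}(\Sigma\cup\Psi)$, $g{:}A'_1\to^1\cdots\to^1A'_m\to^1a$, $g\ne h$, then $\Psi\vdash\mathrm{Not}(h\,M_1^1\dots M_n^1)\Rightarrow g\,(Z_1\Psi^u)^1\dots(Z_m\Psi^u)^1:a$; if $\Psi\vdash\mathrm{Not}(M_i)\Rightarrow N:A_i$ then $\Psi\vdash\mathrm{Not}(h\,M_1^1\dots M_n^1)\Rightarrow h\,(Z_1\Psi^u)^1\dots(Z_{i-1}\Psi^u)^1N^1(Z_{i+1}\Psi^u)^1\dots(Z_n\Psi^u)^1:a$.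 -}

module Defs where

open import Data.Nat using (ℕ; zero; suc; _+_)
open import Data.Fin using (Fin)
open import Data.List using (List; []; _∷_; _++_; [_]; length)
open import Data.List.Relation.Unary.Unique.Propositional using (Unique)
open import Data.Vec using (Vec; []; _∷_; lookup; replicate; _[_]≔_)
open import Relation.Binary.PropositionalEquality using (_≡_; _≢_)

data Lbl : Set where
  one zer u : Lbl

NotL : Lbl → Lbl
NotL one = zer
NotL zer = one
NotL u   = u

data Ty : Set where
  base  : ℕ → Ty
  _⇒[_]_ : Ty → Lbl → Ty → Ty

infixr 5 _⇒[_]_

mutual
  data Pos : Ty → Set where
    pbase : ∀ {a} → Pos (base a)
    parr  : ∀ {N P} → Neg N → Pos P → Pos (N ⇒[ one ] P)

  data Neg : Ty → Set where
    nbase : ∀ {a} → Neg (base a)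
    narr  : ∀ {P N} → Pos P → Neg N → Neg (P ⇒[ u ] N)

-- Constants are named by their index in the signature Σ (a list
-- of types); parameters of Ψ are de Bruijn *levels* (index into Ψ, in its
-- standard order x₁ … xₙ, extension Ψ,x:A appends at the end);
-- existential variables form a separate syntactic class, named by ℕ and
-- annotated with their type.

data Tm : Set where
  con  : ℕ → Tm
  var  : ℕ → Tm
  evar : ℕ → Ty → Tm
  lam  : Lbl → Ty → Tm → Tm
  app  : Tm → Tm → Lbl → Tm

data _∋_⦂_ : List Ty → ℕ → Ty → Set where
  here  : ∀ {Γ A} → (A ∷ Γ) ∋ zero ⦂ A
  there : ∀ {Γ A B n} → Γ ∋ n ⦂ A → (B ∷ Γ) ∋ suc n ⦂ A

data Head : Set where
  hc : ℕ → Head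
  hv : ℕ → Head

headTm : Head → Tm
headTm (hc c) = con c
headTm (hv x) = var x

arrows1 : List Ty → ℕ → Ty
arrows1 []       a = base a
arrows1 (A ∷ As) a = A ⇒[ one ] arrows1 As a

data HeadTy (Σ Ψ : List Ty) : Head → List Ty → ℕ → Set where
  hcon : ∀ {c As a} → Σ ∋ c ⦂ arrows1 As a → HeadTy Σ Ψ (hc c) As a
  hvar : ∀ {x As a} → Ψ ∋ x ⦂ arrows1 As a → HeadTy Σ Ψ (hv x) As a

spine1 : Tm → List Tm → Tm
spine1 t []       = t
spine1 t (M ∷ Ms) = spine1 (app t M one) Ms

LSeq : List Ty → Set
LSeq Ψ = Vec Lbl (length Ψ)

arrows : (Ψ : List Ty) → LSeq Ψ → Ty → Ty
arrows []      []      T = T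
arrows (A ∷ Ψ) (k ∷ Φ) T = A ⇒[ k ] arrows Ψ Φ T

gvSpine : ∀ {n} → Tm → ℕ → Vec Lbl n → Tm
gvSpine t i []      = t
gvSpine t i (k ∷ Φ) = gvSpine (app t (var i) k) (suc i) Φ

genVar : ℕ → (Ψ : List Ty) → LSeq Ψ → ℕ → Tm
genVar E Ψ Φ a = gvSpine (evar E (arrows Ψ Φ (base a))) 0 Φ

-- convention: Z Φ at type B₁ →^{l₁} ⋯ Bₘ →^{lₘ} a stands for
-- λ y₁^{l₁}:B₁ … λ yₘ^{lₘ}:Bₘ . Z Φ y₁^{l₁} … yₘ^{lₘ}
etaBody : Tm → ℕ → Ty → Tm
etaBody h i (base a)     = h
etaBody h i (B ⇒[ l ] T) = lam l B (etaBody (app h (var i) l) (suc i) T)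

etaGV : ℕ → (Ψ : List Ty) → LSeq Ψ → Ty → Tm
etaGV Z Ψ Φ T = etaBody (gvSpine (evar Z (arrows Ψ Φ T)) 0 Φ) (length Ψ) T

allU : (Ψ : List Ty) → LSeq Ψ
allU Ψ = replicate (length Ψ) u

NotAt : ∀ {n} → Vec Lbl n → Fin n → Vec Lbl n
NotAt {n} Φ i = replicate n u [ i ]≔ NotL (lookup Φ i)

freshArgs : ℕ → (Ψ : List Ty) → List Ty → List Tm
freshArgs n Ψ []       = []
freshArgs n Ψ (A ∷ As) = etaGV n Ψ (allU Ψ) A ∷ freshArgs (suc n) Ψ As

mutual
  data Pat (Σ : List Ty) : List Ty → Tm → Ty → Set where
    plam : ∀ {Ψ P M B} → Pos P → Pat Σ (Ψ ++ [ P ]) M B →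
           Pat Σ Ψ (lam u P M) (P ⇒[ u ] B)
    phead : ∀ {Ψ h As a Ms} → HeadTy Σ Ψ h As a → Pats Σ Ψ Ms As →
            Pat Σ Ψ (spine1 (headTm h) Ms) (base a)
    pgv : ∀ {Ψ} E (Φ : LSeq Ψ) a → Pat Σ Ψ (genVar E Ψ Φ a) (base a)

  data Pats (Σ : List Ty) (Ψ : List Ty) : List Tm → List Ty → Set where
    []  : Pats Σ Ψ [] []
    _∷_ : ∀ {M A Ms As} → Pat Σ Ψ M A → Pats Σ Ψ Ms As → Pats Σ Ψ (M ∷ Ms) (A ∷ As)

evars : Tm → List ℕ
evars (con c)     = []
evars (var x)     = []
evars (evar E A)  = E ∷ []
evars (lam k A M) = evars M
evars (app M N k) = evars M ++ evars N

Linear : Tm → Set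
Linear M = Unique (evars M)

-- Complement  Ψ ⊢ Not(M) ⇒ N : A.
-- Freshness of the Z's is realised by a name supply: NotJ Σ Ψ n M N A n'
-- draws its fresh existential variables from the names n, n+1, …, n'-1.

data NotJ (Σ : List Ty) : List Ty → ℕ → Tm → Tm → Ty → ℕ → Set where
  notE : ∀ {Ψ n E a} (Φ : LSeq Ψ) (i : Fin (length Ψ)) → lookup Φ i ≢ u →
         NotJ Σ Ψ n (genVar E Ψ Φ a) (genVar n Ψ (NotAt Φ i) a) (base a) (suc n)
  notLam : ∀ {Ψ n n' A M N B} → NotJ Σ (Ψ ++ [ A ]) n M N B n' →
           NotJ Σ Ψ n (lam u A M) (lam u A N) (A ⇒[ u ] B) n'
  notOther : ∀ {Ψ n h g As Bs a Ms} → HeadTy Σ Ψ h As a → length Ms ≡ length As →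
             HeadTy Σ Ψ g Bs a → g ≢ h →
             NotJ Σ Ψ n (spine1 (headTm h) Ms)
                        (spine1 (headTm g) (freshArgs n Ψ Bs)) (base a) (n + length Bs)
  notArg : ∀ {Ψ n n' h As₁ A As₂ a Ms₁ M Ms₂ N} →
           HeadTy Σ Ψ h (As₁ ++ A ∷ As₂) a →
           length Ms₁ ≡ length As₁ → length Ms₂ ≡ length As₂ →
           NotJ Σ Ψ n M N A n' →
           NotJ Σ Ψ n (spine1 (headTm h) (Ms₁ ++ M ∷ Ms₂))
                      (spine1 (headTm h) (freshArgs n' Ψ As₁ ++ N ∷ freshArgs (n' + length As₁) Ψ As₂))
                      (base a) (n' + length As₁ + length As₂)

{-# OPTIONS --safe #-}
-- Every argument the complement does not descend into is replaced by a fresh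
-- eta-expanded Z Ψ^u.  Constants and parameters have positive types, so their
-- argument types are negative, P₁ →ᵘ ⋯ →ᵘ Pₘ →ᵘ a with positive Pⱼ, and at such a
-- type the eta-expansion of Z Ψ^u is a simple pattern.  Linearity does not depend
-- on M at all: the existential variables of N are the fresh names n, …, n'−1 drawn
-- by the derivation, each occurring once.
module Submission where

open import Defs
open import Data.Nat using (ℕ; suc; _+_; _≤_; _<_)
open import Data.Nat.Properties using (+-identityʳ; +-suc; +-comm; ≤-refl; ≤-trans; <-≤-trans; <⇒≱; m≤m+n; n≤1+n; suc-injective)
open import Data.List using (List; []; _∷_; _++_; [_]; length; concatMap)
open import Data.List.Properties using (++-assoc; ++-identityʳ; length-++; concatMap-++)
open import Data.List.Relation.Unary.All using (All; []; _∷_)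
import Data.List.Relation.Unary.All as All
open import Data.List.Relation.Unary.All.Properties using (++⁺; ++⁻; ∷ʳ⁺)
open import Data.List.Relation.Unary.Unique.Propositional using (Unique; []; _∷_)
import Data.List.Relation.Unary.Unique.Propositional.Properties as Unique
open import Data.List.Relation.Binary.Disjoint.Propositional using (Disjoint)
import Data.List.Relation.Binary.Disjoint.Propositional.Properties as Disjoint
open import Data.Vec using (Vec; []; _∷_)
open import Data.Product using (_×_; _,_; proj₁; proj₂)
open import Data.Empty using (⊥-elim)
open import Relation.Binary.PropositionalEquality using (_≡_; _≢_; refl; sym; trans; cong; cong₂; subst; subst₂; module ≡-Reasoning)

private
  variable
    Σ Ψ Γ As Bs : List Ty
    A B T : Ty
    M N : Tm
    Ms : List Tm
    a b c d n n' x : ℕ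
    xs ys : List ℕ
    h : Head
    k : Lbl

evars-spine1 : ∀ t Ms → evars (spine1 t Ms) ≡ evars t ++ concatMap evars Ms
evars-spine1 t []       = sym (++-identityʳ (evars t))
evars-spine1 t (M ∷ Ms) = trans (evars-spine1 (app t M one) Ms) (++-assoc (evars t) (evars M) _)

evars-headSpine : ∀ h Ms → evars (spine1 (headTm h) Ms) ≡ concatMap evars Ms
evars-headSpine (hc c) = evars-spine1 (con c)
evars-headSpine (hv y) = evars-spine1 (var y)

evars-gvSpine : ∀ {m} t i (Φ : Vec Lbl m) → evars (gvSpine t i Φ) ≡ evars t
evars-gvSpine t i []      = refl
evars-gvSpine t i (l ∷ Φ) = trans (evars-gvSpine (app t (var i) l) (suc i) Φ) (++-identityʳ (evars t))

evars-etaBody : ∀ t i B → evars (etaBody t i B) ≡ evars t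
evars-etaBody t i (base _)     = refl
evars-etaBody t i (B ⇒[ l ] T) = trans (evars-etaBody (app t (var i) l) (suc i) T) (++-identityʳ (evars t))

evars-etaGV : ∀ Z Ψ Φ B → evars (etaGV Z Ψ Φ B) ≡ [ Z ]
evars-etaGV Z Ψ Φ B = trans (evars-etaBody _ (length Ψ) B) (evars-gvSpine _ 0 Φ)

InRange : ℕ → ℕ → ℕ → Set
InRange lo hi x = lo ≤ x × x < hi

record DistinctWithin (lo hi : ℕ) (xs : List ℕ) : Set where
  field
    lo≤hi    : lo ≤ hi
    bounded  : All (InRange lo hi) xs
    distinct : Unique xs

open DistinctWithin

inRange-widen : a ≤ b → c ≤ d → All (InRange b c) xs → All (InRange a d) xs
inRange-widen a≤b c≤d = All.map λ (b≤x , x<c) → ≤-trans a≤b b≤x , <-≤-trans x<c c≤d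

inRange-disjoint : b ≤ c → All (InRange a b) xs → All (InRange c d) ys → Disjoint xs ys
inRange-disjoint b≤c xs∈ ys∈ (v∈xs , v∈ys) =
  <⇒≱ (<-≤-trans (proj₂ (All.lookup xs∈ v∈xs)) b≤c) (proj₁ (All.lookup ys∈ v∈ys))

distinctWithin-singleton : DistinctWithin n (suc n) [ n ]
distinctWithin-singleton = record
  { lo≤hi = n≤1+n _ ; bounded = (≤-refl , ≤-refl) ∷ [] ; distinct = [] ∷ [] }

distinctWithin-++ : DistinctWithin a b xs → DistinctWithin b c ys → DistinctWithin a c (xs ++ ys)
distinctWithin-++ X Y = record
  { lo≤hi    = ≤-trans (lo≤hi X) (lo≤hi Y)
  ; bounded  = ++⁺ (inRange-widen ≤-refl (lo≤hi Y) (bounded X)) (inRange-widen (lo≤hi X) ≤-refl (bounded Y))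
  ; distinct = Unique.++⁺ (distinct X) (distinct Y) (inRange-disjoint ≤-refl (bounded X) (bounded Y))
  }

distinctWithin-++-swapped : DistinctWithin b c xs → DistinctWithin a b ys → DistinctWithin a c (xs ++ ys)
distinctWithin-++-swapped X Y = record
  { lo≤hi    = ≤-trans (lo≤hi Y) (lo≤hi X)
  ; bounded  = ++⁺ (inRange-widen (lo≤hi Y) ≤-refl (bounded X)) (inRange-widen ≤-refl (lo≤hi X) (bounded Y))
  ; distinct = Unique.++⁺ (distinct X) (distinct Y)
                 (Disjoint.sym (inRange-disjoint ≤-refl (bounded Y) (bounded X)))
  }

freshArgs-distinct : ∀ n Ψ Bs → DistinctWithin n (n + length Bs) (concatMap evars (freshArgs n Ψ Bs))
freshArgs-distinct n Ψ []       = record { lo≤hi = m≤m+n n 0 ; bounded = [] ; distinct = [] }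
freshArgs-distinct n Ψ (B ∷ Bs) =
  subst₂ (DistinctWithin n) (sym (+-suc n (length Bs))) (cong (_++ _) (sym (evars-etaGV n Ψ (allU Ψ) B)))
    (distinctWithin-++ distinctWithin-singleton (freshArgs-distinct (suc n) Ψ Bs))

complement-distinct : NotJ Σ Ψ n M N A n' → DistinctWithin n n' (evars N)
complement-distinct (notE {Ψ = Ψ} {n = n} {a = a} Φ i _) =
  subst (DistinctWithin n (suc n)) (sym (evars-etaGV n Ψ (NotAt Φ i) (base a))) distinctWithin-singleton
complement-distinct (notLam nj) = complement-distinct nj
complement-distinct (notOther {Ψ = Ψ} {n = n} {g = g} {Bs = Bs} _ _ _ _) =
  subst (DistinctWithin n (n + length Bs)) (sym (evars-headSpine g (freshArgs n Ψ Bs)))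
    (freshArgs-distinct n Ψ Bs)
-- The names n' … for the arguments before N are drawn after those of N, hence the swap.
complement-distinct (notArg {Ψ = Ψ} {n' = n'} {h = h} {As₁ = As₁} {As₂ = As₂} {N = N} _ _ _ nj) =
  subst (DistinctWithin _ _) (sym evars-complement)
    (distinctWithin-++ (distinctWithin-++-swapped (freshArgs-distinct n' Ψ As₁) (complement-distinct nj))
                       (freshArgs-distinct (n' + length As₁) Ψ As₂))
  where
  open ≡-Reasoning
  Zs₁ Zs₂ : List Tm
  Zs₁ = freshArgs n' Ψ As₁
  Zs₂ = freshArgs (n' + length As₁) Ψ As₂
  evars-complement : evars (spine1 (headTm h) (Zs₁ ++ N ∷ Zs₂))
                   ≡ (concatMap evars Zs₁ ++ evars N) ++ concatMap evars Zs₂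
  evars-complement = begin
    evars (spine1 (headTm h) (Zs₁ ++ N ∷ Zs₂))            ≡⟨ evars-headSpine h (Zs₁ ++ N ∷ Zs₂) ⟩
    concatMap evars (Zs₁ ++ N ∷ Zs₂)                        ≡⟨ concatMap-++ evars Zs₁ (N ∷ Zs₂) ⟩
    concatMap evars Zs₁ ++ evars N ++ concatMap evars Zs₂   ≡⟨ ++-assoc (concatMap evars Zs₁) (evars N) _ ⟨
    (concatMap evars Zs₁ ++ evars N) ++ concatMap evars Zs₂ ∎

headOf : Tm → Tm
headOf (app t _ _) = headOf t
headOf t           = t

spineArgs : Tm → List Tm
spineArgs (app t M one) = spineArgs t ++ [ M ]
spineArgs _             = []

headOf-spine1 : ∀ t Ms → headOf (spine1 t Ms) ≡ headOf t
headOf-spine1 t []       = refl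
headOf-spine1 t (M ∷ Ms) = headOf-spine1 (app t M one) Ms

headOf-gvSpine : ∀ {m} t i (Φ : Vec Lbl m) → headOf (gvSpine t i Φ) ≡ headOf t
headOf-gvSpine t i []      = refl
headOf-gvSpine t i (l ∷ Φ) = headOf-gvSpine (app t (var i) l) (suc i) Φ

spineArgs-spine1 : ∀ t Ms → spineArgs (spine1 t Ms) ≡ spineArgs t ++ Ms
spineArgs-spine1 t []       = sym (++-identityʳ (spineArgs t))
spineArgs-spine1 t (M ∷ Ms) = trans (spineArgs-spine1 (app t M one) Ms) (++-assoc (spineArgs t) [ M ] Ms)

headOf-headSpine : ∀ h Ms → headOf (spine1 (headTm h) Ms) ≡ headTm h
headOf-headSpine (hc c) = headOf-spine1 (con c)
headOf-headSpine (hv y) = headOf-spine1 (var y)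

spineArgs-headSpine : ∀ h Ms → spineArgs (spine1 (headTm h) Ms) ≡ Ms
spineArgs-headSpine (hc c) = spineArgs-spine1 (con c)
spineArgs-headSpine (hv y) = spineArgs-spine1 (var y)

headTm-injective : ∀ {h h'} → headTm h ≡ headTm h' → h ≡ h'
headTm-injective {hc _} {hc _} refl = refl
headTm-injective {hv _} {hv _} refl = refl

headSpine-injective : ∀ {h h' Ms Ms'} → spine1 (headTm h) Ms ≡ spine1 (headTm h') Ms' → h ≡ h' × Ms ≡ Ms'
headSpine-injective {h} {h'} {Ms} {Ms'} eq =
  headTm-injective (trans (sym (headOf-headSpine h Ms)) (trans (cong headOf eq) (headOf-headSpine h' Ms'))) ,
  trans (sym (spineArgs-headSpine h Ms)) (trans (cong spineArgs eq) (spineArgs-headSpine h' Ms'))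

lam≢headSpine : ∀ h Ms → lam k A M ≢ spine1 (headTm h) Ms
lam≢headSpine h Ms eq = lam≢headTm h (trans (cong headOf eq) (headOf-headSpine h Ms))
  where
  lam≢headTm : ∀ h → lam k A M ≢ headTm h
  lam≢headTm (hc _) ()
  lam≢headTm (hv _) ()

genVar≢headSpine : ∀ E Ψ (Φ : LSeq Ψ) a h Ms → genVar E Ψ Φ a ≢ spine1 (headTm h) Ms
genVar≢headSpine E Ψ Φ a h Ms eq =
  evar≢headTm h (trans (sym (headOf-gvSpine _ 0 Φ)) (trans (cong headOf eq) (headOf-headSpine h Ms)))
  where
  evar≢headTm : ∀ h → evar E T ≢ headTm h
  evar≢headTm (hc _) ()
  evar≢headTm (hv _) ()

∋-functional : Γ ∋ x ⦂ A → Γ ∋ x ⦂ B → A ≡ B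
∋-functional here      here      = refl
∋-functional (there p) (there q) = ∋-functional p q

arrows1-injective : ∀ As Bs → arrows1 As a ≡ arrows1 Bs b → As ≡ Bs
arrows1-injective []       []       _  = refl
arrows1-injective (A ∷ As) (B ∷ Bs) eq = cong₂ _∷_ (domain eq) (arrows1-injective As Bs (codomain eq))
  where
  domain : ∀ {A B C D} → A ⇒[ one ] C ≡ B ⇒[ one ] D → A ≡ B
  domain refl = refl
  codomain : ∀ {A B C D} → A ⇒[ one ] C ≡ B ⇒[ one ] D → C ≡ D
  codomain refl = refl

headTy-functional : HeadTy Σ Ψ h As a → HeadTy Σ Ψ h Bs b → As ≡ Bs
headTy-functional {As = As} {Bs = Bs} (hcon p) (hcon q) = arrows1-injective As Bs (∋-functional p q)
headTy-functional {As = As} {Bs = Bs} (hvar p) (hvar q) = arrows1-injective As Bs (∋-functional p q)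

headSpine-pats : HeadTy Σ Ψ h As a → Pat Σ Ψ (spine1 (headTm h) Ms) T → Pats Σ Ψ Ms As
headSpine-pats {Σ = Σ} {Ψ = Ψ} {h = h} {As = As} {Ms = Ms} hty p = invert p refl
  where
  invert : ∀ {M T} → Pat Σ Ψ M T → M ≡ spine1 (headTm h) Ms → Pats Σ Ψ Ms As
  invert (plam _ _)    eq = ⊥-elim (lam≢headSpine h Ms eq)
  invert (pgv E Φ a)   eq = ⊥-elim (genVar≢headSpine E Ψ Φ a h Ms eq)
  invert (phead {h = h′} {Ms = Ms′} hty′ ps) eq with headSpine-injective {h′} {h} {Ms′} {Ms} eq
  ... | refl , refl = subst (Pats Σ Ψ Ms) (headTy-functional hty′ hty) ps

∋-All : {P : Ty → Set} → All P Γ → Γ ∋ x ⦂ A → P A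
∋-All (p ∷ _)  here      = p
∋-All (_ ∷ ps) (there q) = ∋-All ps q

pos-arrows1⇒args-neg : ∀ As → Pos (arrows1 As a) → All Neg As
pos-arrows1⇒args-neg []       _            = []
pos-arrows1⇒args-neg (A ∷ As) (parr nA pB) = nA ∷ pos-arrows1⇒args-neg As pB

headTy-args-neg : All Pos Σ → All Pos Ψ → HeadTy Σ Ψ h As a → All Neg As
headTy-args-neg {As = As} posΣ _    (hcon c) = pos-arrows1⇒args-neg As (∋-All posΣ c)
headTy-args-neg {As = As} _    posΨ (hvar y) = pos-arrows1⇒args-neg As (∋-All posΨ y)

arrows-allU-snoc : ∀ Ψ P B → arrows (Ψ ++ [ P ]) (allU (Ψ ++ [ P ])) B ≡ arrows Ψ (allU Ψ) (P ⇒[ u ] B)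
arrows-allU-snoc []      P B = refl
arrows-allU-snoc (A ∷ Ψ) P B = cong (A ⇒[ u ]_) (arrows-allU-snoc Ψ P B)

gvSpine-allU-snoc : ∀ Ψ P t i → gvSpine t i (allU (Ψ ++ [ P ])) ≡ app (gvSpine t i (allU Ψ)) (var (i + length Ψ)) u
gvSpine-allU-snoc []      P t i = cong (λ j → app t (var j) u) (sym (+-identityʳ i))
gvSpine-allU-snoc (A ∷ Ψ) P t i =
  trans (gvSpine-allU-snoc Ψ P (app t (var i) u) (suc i))
        (cong (λ j → app (gvSpine (app t (var i) u) (suc i) (allU Ψ)) (var j) u) (sym (+-suc i (length Ψ))))

etaGV-allU-snoc : ∀ Z Ψ P B →
  lam u P (etaGV Z (Ψ ++ [ P ]) (allU (Ψ ++ [ P ])) B) ≡ etaGV Z Ψ (allU Ψ) (P ⇒[ u ] B)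
etaGV-allU-snoc Z Ψ P B = cong (lam u P) (begin
  etaBody (gvSpine (evar Z (arrows (Ψ ++ [ P ]) Uᵖ B)) 0 Uᵖ) (length (Ψ ++ [ P ])) B
    ≡⟨ cong (λ T → etaBody (gvSpine (evar Z T) 0 Uᵖ) (length (Ψ ++ [ P ])) B) (arrows-allU-snoc Ψ P B) ⟩
  etaBody (gvSpine Zᵖ 0 Uᵖ) (length (Ψ ++ [ P ])) B
    ≡⟨ cong (λ t → etaBody t (length (Ψ ++ [ P ])) B) (gvSpine-allU-snoc Ψ P Zᵖ 0) ⟩
  etaBody Zᵖy (length (Ψ ++ [ P ])) B
    ≡⟨ cong (λ i → etaBody Zᵖy i B) (trans (length-++ Ψ) (+-comm (length Ψ) 1)) ⟩
  etaBody Zᵖy (suc (length Ψ)) B ∎)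
  where
  open ≡-Reasoning
  Uᵖ : LSeq (Ψ ++ [ P ])
  Uᵖ = allU (Ψ ++ [ P ])
  Zᵖ Zᵖy : Tm
  Zᵖ = evar Z (arrows Ψ (allU Ψ) (P ⇒[ u ] B))
  Zᵖy = app (gvSpine Zᵖ 0 (allU Ψ)) (var (length Ψ)) u

etaGV-pat : ∀ Z Ψ → Neg B → Pat Σ Ψ (etaGV Z Ψ (allU Ψ) B) B
etaGV-pat         Z Ψ nbase                            = pgv Z (allU Ψ) _
etaGV-pat {Σ = Σ} Z Ψ (narr {P = P} {N = B} pP nB) =
  subst (λ t → Pat Σ Ψ t (P ⇒[ u ] B)) (etaGV-allU-snoc Z Ψ P B) (plam pP (etaGV-pat Z (Ψ ++ [ P ]) nB))

freshArgs-pats : ∀ n Ψ → All Neg Bs → Pats Σ Ψ (freshArgs n Ψ Bs) Bs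
freshArgs-pats n Ψ []         = []
freshArgs-pats n Ψ (nB ∷ nBs) = etaGV-pat n Ψ nB ∷ freshArgs-pats (suc n) Ψ nBs

Pats-++ : ∀ {Ms Ns} → Pats Σ Ψ Ms As → Pats Σ Ψ Ns Bs → Pats Σ Ψ (Ms ++ Ns) (As ++ Bs)
Pats-++ []       qs = qs
Pats-++ (p ∷ ps) qs = p ∷ Pats-++ ps qs

Pats-middle : ∀ {Ms₂ As₂} Ms₁ As₁ → length Ms₁ ≡ length As₁ →
              Pats Σ Ψ (Ms₁ ++ M ∷ Ms₂) (As₁ ++ A ∷ As₂) → Pat Σ Ψ M A
Pats-middle []       []       _  (p ∷ _)  = p
Pats-middle (_ ∷ Ms) (_ ∷ As) eq (_ ∷ ps) = Pats-middle Ms As (suc-injective eq) ps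

complement-pat : All Pos Σ → All Pos Ψ → Pat Σ Ψ M A → NotJ Σ Ψ n M N A n' → Pat Σ Ψ N A
complement-pat _    _    _            (notE {n = n} {a = a} Φ i _) = pgv n (NotAt Φ i) a
complement-pat posΣ posΨ (plam pP p)  (notLam nj)                  = plam pP (complement-pat posΣ (∷ʳ⁺ posΨ pP) p nj)
complement-pat posΣ posΨ _            (notOther {Ψ = Ψ} {n = n} _ _ gty _) =
  phead gty (freshArgs-pats n Ψ (headTy-args-neg posΣ posΨ gty))
complement-pat posΣ posΨ p (notArg {Ψ = Ψ} {n' = n'} {As₁ = As₁} {As₂ = As₂} {Ms₁ = Ms₁} hty |Ms₁| _ nj) =
  phead hty (Pats-++ (freshArgs-pats n' Ψ negAs₁)
                     (complement-pat posΣ posΨ (Pats-middle Ms₁ As₁ |Ms₁| (headSpine-pats hty p)) nj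
                      ∷ freshArgs-pats _ Ψ negAs₂))
  where
  negAs₁ : All Neg As₁
  negAs₁ = proj₁ (++⁻ As₁ (headTy-args-neg posΣ posΨ hty))
  negAs₂ : All Neg As₂
  negAs₂ = All.tail (proj₂ (++⁻ As₁ (headTy-args-neg posΣ posΨ hty)))

theorem6p8 : (Σ Ψ : List Ty) → All Pos Σ → All Pos Ψ →
             (M N : Tm) (A : Ty) (n n' : ℕ) →
             Pat Σ Ψ M A → Linear M →
             NotJ Σ Ψ n M N A n' →
             Pat Σ Ψ N A × Linear N
theorem6p8 Σ Ψ posΣ posΨ M N A n n' p _ nj = complement-pat posΣ posΨ p nj , distinct (complement-distinct nj)
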